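{- Let $H^\infty:\mathbb N^*\to\mathbb N$ be the sequence with $H^\infty_i=1$ for all $i\ge1$, and let $\lambda^{(t)}=\Phi^t(H^\infty)$. Let $k\ge1$ and $t=T_k+r$ with $0\le r\le k$. Then \[ \lambda_i^{(t)}=\begin{cases} k-i+2 & \text{if } 1\le i\le k-r+1,\\ k-i+3 & \text{if } k-r+1<i\le k+1,\\ 1 & \text{if } i>k+1.\end{cases} \]
   Context: $T_j=j(j+1)/2$. For any sequence $\lambda:\mathbb N^*\to\mathbb N$ the move $\Phi$ is defined by $\mu=\Phi(\lambda)$, $\mu_i=\lambda_{i+1}+1$ for $1\le i\le\lambda_1$ and $\mu_i=\lambda_{i+1}$ for $i>\lambda_1$; $\Phi^t$ is its $t$-fold iterate. -}

module Defs where

open import Data.Nat using (ℕ; zero; suc; _+_; _*_; _/_; _≤ᵇ_)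
open import Data.Bool using (if_then_else_)

-- A sequence ℕ* → ℕ, represented as ℕ → ℕ; the value at index 0 is
-- irrelevant (never read by Φ, never mentioned in the theorem).
Seq : Set
Seq = ℕ → ℕ

T : ℕ → ℕ
T j = (j * suc j) / 2

Φ : Seq → Seq
Φ lam zero    = 0
Φ lam (suc n) = if suc n ≤ᵇ lam 1 then lam (suc (suc n)) + 1 else lam (suc (suc n))

Φ^ : ℕ → Seq → Seq
Φ^ zero    lam = lam
Φ^ (suc t) lam = Φ (Φ^ t lam)

H∞ : Seq
H∞ _ = 1

-- Put k = r + s and call the sequence k+1, k, …, r+1, r+1, r, …, 2, 1, 1, … the staircase
-- (r, s): the staircase of height k+1 with the value r+1 doubled.  Φ takes the staircase
-- (r, s+1) to (r+1, s), moving the doubled value one place towards the head, and the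
-- staircase (r, 0) to the plain staircase (0, r+1) of height r+2.  Since H∞ is the staircase
-- (0, 0) and climbing from height k+1 to k+2 takes k+1 moves, Φ^(T_k) H∞ is the staircase
-- (0, k) and Φ^(T_k + r) H∞ is the staircase (r, k − r).
module Submission where

open import Defs
open import Data.Nat using (ℕ; _+_; _∸_; _≤_; _<_)
open import Data.Product using (_×_)
open import Relation.Binary.PropositionalEquality using (_≡_)

open import Data.Bool using (true; false)
open import Data.List using ([]; _∷_)
open import Data.Nat using (zero; suc; _*_; _/_; _≤ᵇ_; s≤s; s≤s⁻¹)
open import Data.Nat.DivMod using (+-distrib-/-∣ʳ; m*n/n≡m)
open import Data.Nat.Divisibility using (n∣m*n)
open import Data.Nat.Properties
open import Data.Nat.Tactic.RingSolver using (solve)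
open import Data.Product using (_,_)
open import Data.Unit using (tt)
open import Function using (_∘_)
open import Relation.Binary.PropositionalEquality
  using (refl; sym; trans; cong; subst; subst₂; module ≡-Reasoning)
open import Relation.Nullary using (contradiction)

open ≡-Reasoning

T-suc : ∀ k → T (suc k) ≡ suc k + T k
T-suc k = begin
  suc k * (2 + k) / 2          ≡⟨ cong (_/ 2) expand ⟩
  (k * suc k + suc k * 2) / 2  ≡⟨ +-distrib-/-∣ʳ (k * suc k) (n∣m*n (suc k)) ⟩
  T k + suc k * 2 / 2          ≡⟨ cong (T k +_) (m*n/n≡m (suc k) 2) ⟩
  T k + suc k                  ≡⟨ +-comm (T k) (suc k) ⟩
  suc k + T k                  ∎
  where
  expand : suc k * (2 + k) ≡ k * suc k + suc k * 2
  expand = solve (k ∷ [])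

m+n≡o⇒o∸m≡n : ∀ m n {o} → m + n ≡ o → o ∸ m ≡ n
m+n≡o⇒o∸m≡n m n refl = m+n∸m≡n m n

s+2+m≤r+s+1⇒m<r : ∀ r s m → suc (s + 1) + m ≤ r + s + 1 → m < r
s+2+m≤r+s+1⇒m<r r s m le = +-cancelʳ-≤ (s + 1) (suc m) r (subst₂ _≤_ shuffle (+-assoc r s 1) le)
  where
  shuffle : suc (s + 1) + m ≡ suc m + (s + 1)
  shuffle = solve (s ∷ m ∷ [])

Φ-within-head : ∀ f n → suc n ≤ f 1 → Φ f (suc n) ≡ suc (f (2 + n))
Φ-within-head f n n<f₁ with suc n ≤ᵇ f 1 | ≤⇒≤ᵇ n<f₁
... | true | _ = +-comm (f (2 + n)) 1

Φ-beyond-head : ∀ f n → f 1 ≤ n → Φ f (suc n) ≡ f (2 + n)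
Φ-beyond-head f n f₁≤n with suc n ≤ᵇ f 1 | ≤ᵇ⇒≤ (suc n) (f 1)
... | false | _    = refl
... | true  | n<f₁ = contradiction (n<f₁ tt) (<⇒≱ (s≤s f₁≤n))

Φ^-+ : ∀ m n f → Φ^ (m + n) f ≡ Φ^ m (Φ^ n f)
Φ^-+ zero    n f = refl
Φ^-+ (suc m) n f = cong Φ (Φ^-+ m n f)

-- The staircase (r, s) of the header; positions are written additively (n + d ≡ s, …) so
-- that no truncated subtraction occurs.
record Staircase (r s : ℕ) (f : Seq) : Set where
  field
    descent : ∀ n d → n + d ≡ s → f (suc n) ≡ suc (r + d)
    repeat  : ∀ m e → suc (m + e) ≡ r → f (2 + s + m) ≡ 2 + e
    ones    : ∀ m → f (2 + (r + s) + m) ≡ 1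

  head : f 1 ≡ suc (r + s)
  head = descent 0 s refl

  Φ-within : ∀ n → n ≤ r + s → Φ f (suc n) ≡ suc (f (2 + n))
  Φ-within n n≤r+s = Φ-within-head f n (subst (suc n ≤_) (sym head) (s≤s n≤r+s))

  Φ-beyond : ∀ n → r + s ≤ n → Φ f (2 + n) ≡ f (3 + n)
  Φ-beyond n r+s≤n = Φ-beyond-head f (suc n) (subst (_≤ suc n) (sym head) (s≤s r+s≤n))

open Staircase

staircase-H∞ : Staircase 0 0 H∞
staircase-H∞ .descent n d n+d≡0 = cong suc (sym (m+n≡0⇒n≡0 n n+d≡0))
staircase-H∞ .repeat m e ()
staircase-H∞ .ones m = refl

Φ-staircase-shift : ∀ {r s f} → Staircase r (suc s) f → Staircase (suc r) s (Φ f)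
Φ-staircase-shift {r} {s} {f} q = λ where
    .descent n d refl → begin
      Φ f (suc n)      ≡⟨ Φ-within q n (≤-trans (m≤n⇒m≤1+n (m≤m+n n d)) (m≤n+m _ r)) ⟩
      suc (f (2 + n))  ≡⟨ cong suc (descent q (suc n) d refl) ⟩
      suc (suc r + d)  ∎
    .repeat m zero refl → begin
      Φ f (2 + s + m)                    ≡⟨ Φ-within q (suc s + m) (repeat-bound m 0) ⟩
      suc (f (2 + suc s + m))            ≡⟨ cong (suc ∘ f) (solve (m ∷ s ∷ [])) ⟩
      suc (f (2 + (m + 0 + suc s) + 0))  ≡⟨ cong suc (ones q 0) ⟩
      2                                  ∎
    .repeat m (suc e) refl → begin
      Φ f (2 + s + m)          ≡⟨ Φ-within q (suc s + m) (repeat-bound m (suc e)) ⟩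
      suc (f (2 + suc s + m))  ≡⟨ cong suc (repeat q m e (sym (+-suc m e))) ⟩
      3 + e                    ∎
    .ones m → begin
      Φ f (2 + (suc r + s) + m)    ≡⟨ Φ-beyond q (suc (r + s + m)) (ones-bound m) ⟩
      f (4 + (r + s + m))          ≡⟨ cong f (solve (r ∷ s ∷ m ∷ [])) ⟩
      f (2 + (r + suc s) + suc m)  ≡⟨ ones q (suc m) ⟩
      1                            ∎
  where
  ones-bound : ∀ m → r + suc s ≤ suc (r + s + m)
  ones-bound m = ≤-trans (≤-reflexive (+-suc r s)) (s≤s (m≤m+n (r + s) m))
  repeat-bound : ∀ m e → suc s + m ≤ m + e + suc s
  repeat-bound m e = ≤-trans (≤-reflexive (+-comm (suc s) m)) (+-monoˡ-≤ (suc s) (m≤m+n m e))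

Φ-staircase-wrap : ∀ {r f} → Staircase r 0 f → Staircase 0 (suc r) (Φ f)
Φ-staircase-wrap {r} {f} q = λ where
    .descent n d n+d≡1+r → wrapped n d (trans (+-comm d n) n+d≡1+r)
    .repeat m e ()
    .ones m → begin
      Φ f (2 + suc r + m)            ≡⟨ Φ-beyond q (suc (r + m)) (ones-bound m) ⟩
      f (4 + (r + m))                ≡⟨ cong f (solve (r ∷ m ∷ [])) ⟩
      f (2 + (r + 0) + suc (suc m))  ≡⟨ ones q (suc (suc m)) ⟩
      1                              ∎
  where
  r+0≤r : r + 0 ≤ r
  r+0≤r = ≤-reflexive (+-identityʳ r)
  ones-bound : ∀ m → r + 0 ≤ suc (r + m)
  ones-bound m = ≤-trans r+0≤r (m≤n⇒m≤1+n (m≤m+n r m))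
  wrapped : ∀ n d → d + n ≡ suc r → Φ f (suc n) ≡ suc d
  wrapped .(suc r) zero refl = begin
    Φ f (2 + r)          ≡⟨ Φ-beyond q r r+0≤r ⟩
    f (3 + r)            ≡⟨ cong f (solve (r ∷ [])) ⟩
    f (2 + (r + 0) + 1)  ≡⟨ ones q 1 ⟩
    1                    ∎
  wrapped .r (suc zero) refl = begin
    Φ f (suc r)                ≡⟨ Φ-within q r (≤-reflexive (sym (+-identityʳ r))) ⟩
    suc (f (2 + r))            ≡⟨ cong (suc ∘ f) (solve (r ∷ [])) ⟩
    suc (f (2 + (r + 0) + 0))  ≡⟨ cong suc (ones q 0) ⟩
    2                          ∎
  wrapped n (suc (suc e)) refl = begin
    Φ f (suc n)      ≡⟨ Φ-within q n (≤-trans (m≤n+m n (suc e)) (≤-reflexive (sym (+-identityʳ r)))) ⟩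
    suc (f (2 + n))  ≡⟨ cong suc (repeat q n e (cong suc (+-comm n e))) ⟩
    3 + e            ∎

Φ^-staircase-shift : ∀ r s {f} → Staircase 0 (r + s) f → Staircase r s (Φ^ r f)
Φ^-staircase-shift zero    s q = q
Φ^-staircase-shift (suc r) s {f} q =
  Φ-staircase-shift (Φ^-staircase-shift r (suc s) (subst (λ j → Staircase 0 j f) (sym (+-suc r s)) q))

Φ^T-staircase : ∀ k → Staircase 0 k (Φ^ (T k) H∞)
Φ^T-staircase zero = staircase-H∞
Φ^T-staircase (suc k) rewrite T-suc k | Φ^-+ k (T k) H∞ =
  Φ-staircase-wrap (Φ^-staircase-shift k 0 (subst (λ j → Staircase 0 j (Φ^ (T k) H∞))
                                                   (sym (+-identityʳ k)) (Φ^T-staircase k)))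

Φ^[T+r]-staircase : ∀ r s → Staircase r s (Φ^ (T (r + s) + r) H∞)
Φ^[T+r]-staircase r s rewrite +-comm (T (r + s)) r | Φ^-+ r (T (r + s)) H∞ =
  Φ^-staircase-shift r s (Φ^T-staircase (r + s))

module _ {r s : ℕ} {f : Seq} (q : Staircase r s f) where

  descent-values : ∀ i → 1 ≤ i → i ≤ s + 1 → f i ≡ r + s + 2 ∸ i
  descent-values (suc n) _ n<s+1
    with m≤n⇒∃[o]m+o≡n (s≤s⁻¹ (subst (suc n ≤_) (+-comm s 1) n<s+1))
  ... | d , refl = begin
    f (suc n)                ≡⟨ descent q n d refl ⟩
    suc (r + d)              ≡⟨ m+n≡o⇒o∸m≡n (suc n) _ {r + (n + d) + 2} (solve (r ∷ n ∷ d ∷ [])) ⟨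
    r + (n + d) + 2 ∸ suc n  ∎

  repeat-values : ∀ i → s + 1 < i → i ≤ r + s + 1 → f i ≡ r + s + 3 ∸ i
  repeat-values i s+1<i i≤r+s+1 with m≤n⇒∃[o]m+o≡n s+1<i
  ... | m , refl with m≤n⇒∃[o]m+o≡n (s+2+m≤r+s+1⇒m<r r s m i≤r+s+1)
  ... | e , refl = begin
    f (suc (s + 1) + m)  ≡⟨ cong f (solve (s ∷ m ∷ [])) ⟩
    f (2 + s + m)        ≡⟨ repeat q m e refl ⟩
    2 + e                ≡⟨ m+n≡o⇒o∸m≡n (suc (s + 1) + m) _ {suc (m + e) + s + 3}
                                            (solve (s ∷ m ∷ e ∷ [])) ⟨
    suc (m + e) + s + 3 ∸ (suc (s + 1) + m)  ∎

  ones-values : ∀ i → r + s + 1 < i → f i ≡ 1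
  ones-values i r+s+1<i with m≤n⇒∃[o]m+o≡n r+s+1<i
  ... | m , refl = begin
    f (suc (r + s + 1) + m)  ≡⟨ cong f (solve (r ∷ s ∷ m ∷ [])) ⟩
    f (2 + (r + s) + m)      ≡⟨ ones q m ⟩
    1                        ∎

mainTheorem8 : (k r : ℕ) → 1 ≤ k → r ≤ k →
    ((i : ℕ) → 1 ≤ i → i ≤ k ∸ r + 1 → Φ^ (T k + r) H∞ i ≡ k + 2 ∸ i)
    × ((i : ℕ) → k ∸ r + 1 < i → i ≤ k + 1 → Φ^ (T k + r) H∞ i ≡ k + 3 ∸ i)
    × ((i : ℕ) → k + 1 < i → Φ^ (T k + r) H∞ i ≡ 1)
mainTheorem8 k r _ r≤k with m≤n⇒∃[o]m+o≡n r≤k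
... | s , refl rewrite m+n∸m≡n r s =
  descent-values q , repeat-values q , ones-values q
  where
  q : Staircase r s (Φ^ (T (r + s) + r) H∞)
  q = Φ^[T+r]-staircase r s
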